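{- Let $F_1,\dots,F_n$ be matchings, each of size $n$, in a graph containing no cycle of length $3$ and no cycle of length $5$. Let $R$ be a rainbow matching of maximum possible size $q$, with a fixed injection $\phi:R\to[n]$ satisfying $e\in F_{\phi(e)}$ for all $e\in R$, and let $J=[n]\setminus\phi(R)$. For $j\in J$, call a pair $\{e,f\}$ of distinct edges of $R$ half-$j$-wasteful if $F_j$ contains edges $g_e,g_f,g_{ef}$ such that $g_e$ intersects $e$ and no other edge of $R$, $g_f$ intersects $f$ and no other edge of $R$, and $g_{ef}$ intersects both $e$ and $f$. For $e\in R$ let $HW(e)$ be the set of $j\in J$ for which there is $f\in R$ with $\{e,f\}$ half-$j$-wasteful. Then $\sum_{e\in R}|HW(e)|\le 2q$.
   Context: A rainbow matching is a matching $M$ together with an injection $\psi:M\to[n]$ with $x\in F_{\psi(x)}$ for every $x\in M$; "maximum possible size" is over all rainbow matchings. The family $(F_1,\dots,F_n)$ may contain repeated matchings. -}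

module Defs where

open import Data.Nat using (ℕ; zero; suc; _+_; _*_; _≤_)
open import Data.Fin using (Fin; zero; suc; inject₁; fromℕ; _≟_)
open import Data.Fin.Properties using (any?; all?)
open import Data.Product using (Σ; ∃; _×_; _,_; proj₁; proj₂)
open import Data.Sum using (_⊎_)
open import Data.List using (List; []; _∷_; length; map; lookup; concatMap; filter; allFin)
open import Data.Nat.ListAction using (sum)
open import Data.List.Relation.Unary.Any using (Any)
open import Data.List.Relation.Unary.All using (All)
import Data.List.Relation.Unary.Any as Any
open import Data.List.Relation.Unary.Unique.Propositional using (Unique)
open import Data.List.Membership.Propositional using (_∈_; _∉_)
open import Relation.Binary.PropositionalEquality using (_≡_; _≢_)
open import Relation.Nullary using (¬_; Dec)
open import Relation.Nullary.Decidable using (¬?; _×-dec_; _⊎-dec_; _→-dec_)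
import Data.List.Membership.DecPropositional as DecMem

HasCycle : {V : ℕ} → (Fin V → Fin V → Set) → ℕ → Set
HasCycle {V} Adj k =
  Σ (Fin (suc k) → Fin V) λ v →
    (v (fromℕ k) ≡ v zero) ×
    (∀ (i : Fin k) → Adj (v (inject₁ i)) (v (suc i))) ×
    (∀ (i j : Fin k) → v (inject₁ i) ≡ v (inject₁ j) → i ≡ j)

-- Edges are (unordered) pairs of vertices, stored as ordered pairs;
-- membership of an edge in an edge list is up to orientation.

Edge : ℕ → Set
Edge V = Fin V × Fin V

endpoints : {V : ℕ} → List (Edge V) → List (Fin V)
endpoints = concatMap (λ e → proj₁ e ∷ proj₂ e ∷ [])

-- A matching: a list of edges whose endpoints are all distinct
-- (in particular no loops and no repeated edges); its size is its length.
IsMatching : {V : ℕ} → List (Edge V) → Set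
IsMatching M = Unique (endpoints M)

_∈ₑ_ : {V : ℕ} → Edge V → List (Edge V) → Set
(u , v) ∈ₑ F = ((u , v) ∈ F) ⊎ ((v , u) ∈ F)

Meets : {V : ℕ} → Edge V → Edge V → Set
Meets (a , b) (c , d) = (a ≡ c ⊎ a ≡ d) ⊎ (b ≡ c ⊎ b ≡ d)

-- A rainbow matching is a list of pairs (edge , colour) — i.e. a matching M
-- together with the injection ψ : M → [n] — such that the edges form a
-- matching, the colours are distinct, and each edge lies in F ψ(edge).

IsRainbow : {V n : ℕ} → (Fin n → List (Edge V)) → List (Edge V × Fin n) → Set
IsRainbow F R =
  IsMatching (map proj₁ R) × Unique (map proj₂ R) ×
  All (λ p → proj₁ p ∈ₑ F (proj₂ p)) R

IsMaxRainbow : {V n : ℕ} → (Fin n → List (Edge V)) → List (Edge V × Fin n) → Set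
IsMaxRainbow F R =
  IsRainbow F R × (∀ R' → IsRainbow F R' → length R' ≤ length R)

-- Half-wasteful pairs; edges of R are addressed by their position in R.

module _ {V n : ℕ} (F : Fin n → List (Edge V)) (R : List (Edge V × Fin n)) where

  edgeOf : Fin (length R) → Edge V
  edgeOf k = proj₁ (lookup R k)

  InJ : Fin n → Set
  InJ j = j ∉ map proj₂ R

  MeetsOnly : Fin (length R) → Edge V → Set
  MeetsOnly k g = Meets g (edgeOf k) × (∀ k' → k' ≢ k → ¬ Meets g (edgeOf k'))

  HalfWasteful : Fin n → Fin (length R) → Fin (length R) → Set
  HalfWasteful j k l =
    k ≢ l ×
    Any (MeetsOnly k) (F j) ×
    Any (MeetsOnly l) (F j) ×
    Any (λ g → Meets g (edgeOf k) × Meets g (edgeOf l)) (F j)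

  HW : Fin (length R) → Fin n → Set
  HW k j = InJ j × ∃ λ l → HalfWasteful j k l

  private
    meets? : (g e : Edge V) → Dec (Meets g e)
    meets? (a , b) (c , d) = ((a ≟ c) ⊎-dec (a ≟ d)) ⊎-dec ((b ≟ c) ⊎-dec (b ≟ d))

    meetsOnly? : ∀ k g → Dec (MeetsOnly k g)
    meetsOnly? k g = meets? g (edgeOf k) ×-dec
      all? (λ k' → ¬? (k' ≟ k) →-dec ¬? (meets? g (edgeOf k')))

    hw? : ∀ j k l → Dec (HalfWasteful j k l)
    hw? j k l = ¬? (k ≟ l) ×-dec Any.any? (meetsOnly? k) (F j)
      ×-dec Any.any? (meetsOnly? l) (F j)
      ×-dec Any.any? (λ g → meets? g (edgeOf k) ×-dec meets? g (edgeOf l)) (F j)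

  HW? : ∀ k j → Dec (HW k j)
  HW? k j = ¬? (DecMem._∈?_ _≟_ j (map proj₂ R)) ×-dec any? (hw? j k)

  cardHW : Fin (length R) → ℕ
  cardHW k = length (filter (HW? k) (allFin n))

  sumHW : ℕ
  sumHW = sum (map cardHW (allFin (length R)))

{-# OPTIONS --safe #-}
-- Let J be the colours missed by R, and call an edge ax with a on an edge of R and x off R a
-- pendant. Two pendants with distinct colours of J at the two ends of an edge of R close a
-- triangle or, replacing that edge, give a larger rainbow matching; likewise, for distinct
-- α, j, β ∈ J a path x –α– a –R– b –j– c –R– d –β– y closes a pentagon or augments R. Hence if
-- {e, f} is half-j-wasteful there are no distinct α ∈ HW(e), β ∈ HW(f) both different from j,
-- and for j ∈ HW(e) the edge f is unique. So a rich edge (|HW(e)| ≥ 3) has only partners f with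
-- |HW(f)| ≤ 1; if every rich edge hands one unit per shared colour to each partner, every edge
-- ends with at most 2, whence ∑ |HW(e)| ≤ 2q.
module Submission where

open import Defs
open import Level using (0ℓ)
open import Data.Nat using (ℕ; zero; suc; _+_; _*_; _≤_; _<_; z≤n; s≤s; _≤?_)
open import Data.Nat.Properties
  using ( +-0-commutativeMonoid; +-comm; *-comm; +-identityʳ; +-mono-≤; +-cancelʳ-≤; ≤-trans; ≤-reflexive
        ; ≤-pred; m≤n+m; n≤0⇒n≡0; ≮⇒≥; ≰⇒>; 1+n≰n; module ≤-Reasoning)
import Data.Nat.ListAction as List
open import Data.Fin using (Fin; zero; suc; _≟_; fromℕ; inject₁)
open import Data.Fin.Patterns using (0F; 1F; 2F; 3F; 4F)
open import Data.Fin.Properties using (<⇒≢; suc-injective)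
open import Data.Product using (∃; ∃₂; _×_; _,_; proj₁; proj₂; swap)
open import Data.Sum using (_⊎_; inj₁; inj₂)
open import Data.Empty using (⊥; ⊥-elim)
open import Data.List using (List; []; _∷_; length; map; lookup; tabulate; filter; allFin)
open import Data.List.Properties using (map-id; map-tabulate; tabulate-lookup; length-tabulate)
open import Data.List.Relation.Unary.Any using (here; there; index)
import Data.List.Relation.Unary.Any as Any
open import Data.List.Relation.Unary.Any.Properties using (lookup-index)
open import Data.List.Relation.Unary.All using (All; []; _∷_)
import Data.List.Relation.Unary.All as All
import Data.List.Relation.Unary.All.Properties as All
open import Data.List.Relation.Unary.AllPairs using ([]; _∷_)
import Data.List.Relation.Unary.AllPairs.Properties as AllPairs
open import Data.List.Relation.Unary.Unique.Propositional using (Unique)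
import Data.List.Relation.Unary.Unique.Propositional.Properties as Unique
open import Data.List.Membership.Propositional using (_∈_; _∉_; find)
open import Data.List.Membership.Propositional.Properties using (∈-map⁺; ∈-lookup; ∈-tabulate⁺)
open import Data.Vec using (Vec; []; _∷_)
import Data.Vec as Vec
open import Data.Vec.Functional using (updateAt)
import Data.Vec.Functional as Vector
open import Data.Vec.Functional.Properties using (updateAt-updates; updateAt-minimal)
open import Algebra.Properties.CommutativeMonoid.Sum +-0-commutativeMonoid
  using (sum; sum-syntax; ∑-comm; ∑-distrib-+; sum-cong-≗; sum-replicate-zero)
open import Function using (_∘_; _∘′_; id; const)
open import Relation.Binary.PropositionalEquality
open import Relation.Nullary using (¬_; Dec; yes; no; contradiction)
open import Relation.Nullary.Decidable using (_×-dec_; ¬?)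
open import Relation.Unary using (Pred; Decidable)

-- Edges and matchings

module _ {V : ℕ} where

  infix 4 _∈ᵥ_
  _∈ᵥ_ : Fin V → Edge V → Set
  v ∈ᵥ e = v ≡ proj₁ e ⊎ v ≡ proj₂ e

  shared-vertex : {g e : Edge V} → Meets g e → ∃ λ v → v ∈ᵥ g × v ∈ᵥ e
  shared-vertex (inj₁ v∈e) = _ , inj₁ refl , v∈e
  shared-vertex (inj₂ v∈e) = _ , inj₂ refl , v∈e

  meets : {g e : Edge V} {v : Fin V} → v ∈ᵥ g → v ∈ᵥ e → Meets g e
  meets (inj₁ refl) v∈e = inj₁ v∈e
  meets (inj₂ refl) v∈e = inj₂ v∈e

  meets-sym : {g e : Edge V} → Meets g e → Meets e g
  meets-sym m = let _ , v∈g , v∈e = shared-vertex m in meets v∈e v∈g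

  ¬meets : {a b c d : Fin V} → a ≢ c → a ≢ d → b ≢ c → b ≢ d → ¬ Meets (a , b) (c , d)
  ¬meets a≢c _ _ _ (inj₁ (inj₁ a≡c)) = a≢c a≡c
  ¬meets _ a≢d _ _ (inj₁ (inj₂ a≡d)) = a≢d a≡d
  ¬meets _ _ b≢c _ (inj₂ (inj₁ b≡c)) = b≢c b≡c
  ¬meets _ _ _ b≢d (inj₂ (inj₂ b≡d)) = b≢d b≡d

  other-vertex-unique : {e : Edge V} {u v w : Fin V} →
    u ∈ᵥ e → v ∈ᵥ e → w ∈ᵥ e → u ≢ v → u ≢ w → v ≡ w
  other-vertex-unique (inj₁ refl) (inj₁ refl) _ u≢v _ = ⊥-elim (u≢v refl)
  other-vertex-unique (inj₁ refl) (inj₂ refl) (inj₁ refl) _ u≢w = ⊥-elim (u≢w refl)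
  other-vertex-unique (inj₁ refl) (inj₂ refl) (inj₂ refl) _ _ = refl
  other-vertex-unique (inj₂ refl) (inj₁ refl) (inj₁ refl) _ _ = refl
  other-vertex-unique (inj₂ refl) (inj₁ refl) (inj₂ refl) _ u≢w = ⊥-elim (u≢w refl)
  other-vertex-unique (inj₂ refl) (inj₂ refl) _ u≢v _ = ⊥-elim (u≢v refl)

  other-vertex : {e : Edge V} {a : Fin V} → proj₁ e ≢ proj₂ e → a ∈ᵥ e → ∃ λ x → x ∈ᵥ e × a ≢ x
  other-vertex ends (inj₁ refl) = _ , inj₂ refl , ends
  other-vertex ends (inj₂ refl) = _ , inj₁ refl , λ a≡b → ends (sym a≡b)

  ∈ₑ-swap : {M : List (Edge V)} {a b : Fin V} → (a , b) ∈ₑ M → (b , a) ∈ₑ M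
  ∈ₑ-swap (inj₁ ab∈M) = inj₂ ab∈M
  ∈ₑ-swap (inj₂ ba∈M) = inj₁ ba∈M

  ∈ₑ-from-vertices : {M : List (Edge V)} {e : Edge V} {b c : Fin V} →
    e ∈ₑ M → b ∈ᵥ e → c ∈ᵥ e → b ≢ c → (b , c) ∈ₑ M
  ∈ₑ-from-vertices e∈M (inj₁ refl) (inj₁ refl) b≢c = ⊥-elim (b≢c refl)
  ∈ₑ-from-vertices e∈M (inj₁ refl) (inj₂ refl) _ = e∈M
  ∈ₑ-from-vertices e∈M (inj₂ refl) (inj₁ refl) _ = ∈ₑ-swap e∈M
  ∈ₑ-from-vertices e∈M (inj₂ refl) (inj₂ refl) b≢c = ⊥-elim (b≢c refl)

  head-vertex∉endpoints : {g : Edge V} {M : List (Edge V)} {v : Fin V} →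
    IsMatching (g ∷ M) → v ∈ᵥ g → v ∉ endpoints M
  head-vertex∉endpoints ((_ ∷ a∉) ∷ _) (inj₁ refl) v∈M = All.lookup a∉ v∈M refl
  head-vertex∉endpoints (_ ∷ b∉ ∷ _) (inj₂ refl) v∈M = All.lookup b∉ v∈M refl

  matching-ends-distinct : {M : List (Edge V)} {g : Edge V} → IsMatching M → g ∈ M → proj₁ g ≢ proj₂ g
  matching-ends-distinct ((a≢b ∷ _) ∷ _) (here refl) = a≢b
  matching-ends-distinct (_ ∷ _ ∷ M-matching) (there g∈M) = matching-ends-distinct M-matching g∈M

  module _ {A : Set} (f : A → Edge V) where

    ∈ᵥ-lookup⇒∈endpoints : {xs : List A} {i : Fin (length xs)} {v : Fin V} →
      v ∈ᵥ f (lookup xs i) → v ∈ endpoints (map f xs)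
    ∈ᵥ-lookup⇒∈endpoints {_ ∷ _} {zero} (inj₁ refl) = here refl
    ∈ᵥ-lookup⇒∈endpoints {_ ∷ _} {zero} (inj₂ refl) = there (here refl)
    ∈ᵥ-lookup⇒∈endpoints {_ ∷ xs} {suc i} v∈ = there (there (∈ᵥ-lookup⇒∈endpoints {xs} v∈))

    matching-shared-vertex⇒≡ : (xs : List A) → IsMatching (map f xs) → {i j : Fin (length xs)} {v : Fin V} →
      v ∈ᵥ f (lookup xs i) → v ∈ᵥ f (lookup xs j) → i ≡ j
    matching-shared-vertex⇒≡ (_ ∷ _) _ {zero} {zero} _ _ = refl
    matching-shared-vertex⇒≡ (_ ∷ xs) mat {zero} {suc j} v∈i v∈j =
      ⊥-elim (head-vertex∉endpoints {M = map f xs} mat v∈i (∈ᵥ-lookup⇒∈endpoints {xs} v∈j))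
    matching-shared-vertex⇒≡ (_ ∷ xs) mat {suc i} {zero} v∈i v∈j =
      ⊥-elim (head-vertex∉endpoints {M = map f xs} mat v∈j (∈ᵥ-lookup⇒∈endpoints {xs} v∈i))
    matching-shared-vertex⇒≡ (_ ∷ xs) (_ ∷ _ ∷ mat) {suc i} {suc j} v∈i v∈j =
      cong suc (matching-shared-vertex⇒≡ xs mat v∈i v∈j)

  matching-shared-vertex⇒same-edge : {M : List (Edge V)} → IsMatching M → {g h : Edge V} {v : Fin V} →
    g ∈ M → h ∈ M → v ∈ᵥ g → v ∈ᵥ h → g ≡ h
  matching-shared-vertex⇒same-edge {M} mat {g} {h} g∈M h∈M v∈g v∈h = begin
    g                    ≡⟨ lookup-index g∈M ⟩
    lookup M (index g∈M) ≡⟨ cong (lookup M) same-index ⟩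
    lookup M (index h∈M) ≡⟨ sym (lookup-index h∈M) ⟩
    h                    ∎
    where
    open ≡-Reasoning
    same-index : index g∈M ≡ index h∈M
    same-index = matching-shared-vertex⇒≡ id M (subst IsMatching (sym (map-id M)) mat)
      (subst (_ ∈ᵥ_) (lookup-index g∈M) v∈g) (subst (_ ∈ᵥ_) (lookup-index h∈M) v∈h)

-- Rainbow families

unique-tabulate⇒injective : {A : Set} {m : ℕ} {f : Fin m → A} → Unique (tabulate f) →
  ∀ {i j} → f i ≡ f j → i ≡ j
unique-tabulate⇒injective _ {zero} {zero} _ = refl
unique-tabulate⇒injective (fi∉ ∷ _) {zero} {suc j} eq = contradiction eq (All.lookup fi∉ (∈-tabulate⁺ j))
unique-tabulate⇒injective (fj∉ ∷ _) {suc i} {zero} eq = contradiction (sym eq) (All.lookup fj∉ (∈-tabulate⁺ i))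
unique-tabulate⇒injective (_ ∷ unique) {suc i} {suc j} eq = cong suc (unique-tabulate⇒injective unique eq)

updateAt-elim : {A : Set} {m : ℕ} (P : Fin m → A → Set) {ρ : Fin m → A} {k : Fin m} {y : A} →
  P k y → (∀ i → i ≢ k → P i (ρ i)) → ∀ i → P i (updateAt ρ k (const y) i)
updateAt-elim P {ρ} {k} Pky Pρ i with i ≟ k
... | yes refl = subst (P k) (sym (updateAt-updates k ρ)) Pky
... | no i≢k = subst (P i) (sym (updateAt-minimal i k ρ i≢k)) (Pρ i i≢k)

module _ {V n : ℕ} (F : Fin n → List (Edge V)) where

  Item : Set
  Item = Edge V × Fin n

  Proper : Item → Set
  Proper (e , c) = e ∈ₑ F c × proj₁ e ≢ proj₂ e

  Compatible : Item → Item → Set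
  Compatible (e , c) (e′ , c′) = c ≢ c′ × ¬ Meets e e′

  compatible-sym : {x y : Item} → Compatible x y → Compatible y x
  compatible-sym (c≢c′ , e∩e′=∅) = (λ c′≡c → c≢c′ (sym c′≡c)) , λ m → e∩e′=∅ (meets-sym m)

  record Rainbow {m : ℕ} (ρ : Fin m → Item) : Set where
    field
      proper     : ∀ i → Proper (ρ i)
      compatible : ∀ {i j} → i ≢ j → Compatible (ρ i) (ρ j)

  open Rainbow

  tabulate-rainbow : {m : ℕ} {ρ : Fin m → Item} → Rainbow ρ → IsRainbow F (tabulate ρ)
  tabulate-rainbow {ρ = ρ} rainbow = matching , colours-unique , All.tabulate⁺ (λ i → proj₁ (proper rainbow i))
    where
    vertices : Edge V → List (Fin V)
    vertices e = proj₁ e ∷ proj₂ e ∷ []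

    ∈vertices⇒∈ᵥ : {v : Fin V} {e : Edge V} → v ∈ vertices e → v ∈ᵥ e
    ∈vertices⇒∈ᵥ (here v≡a) = inj₁ v≡a
    ∈vertices⇒∈ᵥ (there (here v≡b)) = inj₂ v≡b

    matching : IsMatching (map proj₁ (tabulate ρ))
    matching rewrite map-tabulate ρ proj₁ | map-tabulate (proj₁ ∘′ ρ) vertices =
      Unique.concat⁺ (All.tabulate⁺ λ i → (proj₂ (proper rainbow i) ∷ []) ∷ [] ∷ [])
        (AllPairs.tabulate⁺-< λ i<j (v∈i , v∈j) →
          proj₂ (compatible rainbow (<⇒≢ i<j)) (meets (∈vertices⇒∈ᵥ v∈i) (∈vertices⇒∈ᵥ v∈j)))

    colours-unique : Unique (map proj₂ (tabulate ρ))
    colours-unique rewrite map-tabulate ρ proj₂ = Unique.tabulate⁺ injective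
      where
      injective : ∀ {i j} → proj₂ (ρ i) ≡ proj₂ (ρ j) → i ≡ j
      injective {i} {j} c≡c′ with i ≟ j
      ... | yes i≡j = i≡j
      ... | no i≢j = contradiction c≡c′ (proj₁ (compatible rainbow i≢j))

  lookup-rainbow : {R : List Item} → IsRainbow F R → Rainbow (lookup R)
  lookup-rainbow {R} (matching , colours-unique , edges-in-F) = record
    { proper     = λ i → All.lookup edges-in-F (∈-lookup i) ,
                         matching-ends-distinct matching (∈-map⁺ proj₁ (∈-lookup {xs = R} i))
    ; compatible = λ i≢j →
        (λ c≡c′ → i≢j (unique-tabulate⇒injective colours-unique′ c≡c′)) ,
        (λ m → let _ , v∈i , v∈j = shared-vertex m in i≢j (matching-shared-vertex⇒≡ proj₁ R matching v∈i v∈j))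
    }
    where
    colours-unique′ : Unique (tabulate (proj₂ ∘′ lookup R))
    colours-unique′ = subst Unique
      (trans (cong (map proj₂) (sym (tabulate-lookup R))) (map-tabulate (lookup R) proj₂)) colours-unique

  cons-rainbow : {m : ℕ} {ρ : Fin m → Item} {x : Item} →
    Rainbow ρ → Proper x → (∀ i → Compatible x (ρ i)) → Rainbow (x Vector.∷ ρ)
  cons-rainbow {ρ = ρ} {x} rainbow x-proper x-compatible = record { proper = proper′ ; compatible = compatible′ }
    where
    proper′ : ∀ i → Proper ((x Vector.∷ ρ) i)
    proper′ zero = x-proper
    proper′ (suc i) = proper rainbow i

    compatible′ : ∀ {i j} → i ≢ j → Compatible ((x Vector.∷ ρ) i) ((x Vector.∷ ρ) j)
    compatible′ {zero} {zero} 0≢0 = contradiction refl 0≢0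
    compatible′ {zero} {suc j} _ = x-compatible j
    compatible′ {suc i} {zero} _ = compatible-sym (x-compatible i)
    compatible′ {suc i} {suc j} i≢j = compatible rainbow (λ i≡j → i≢j (cong suc i≡j))

  update-rainbow : {m : ℕ} {ρ : Fin m → Item} {k : Fin m} {x : Item} →
    Rainbow ρ → Proper x → (∀ i → i ≢ k → Compatible x (ρ i)) → Rainbow (updateAt ρ k (const x))
  update-rainbow {ρ = ρ} {k} {x} rainbow x-proper x-compatible = record { proper = proper′ ; compatible = compatible′ }
    where
    ρ′ : Fin _ → Item
    ρ′ = updateAt ρ k (const x)

    at-k : ρ′ k ≡ x
    at-k = updateAt-updates k ρ

    elsewhere : ∀ {i} → i ≢ k → ρ′ i ≡ ρ i
    elsewhere {i} i≢k = updateAt-minimal i k ρ i≢k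

    proper′ : ∀ i → Proper (ρ′ i)
    proper′ = updateAt-elim (λ _ → Proper) x-proper (λ i _ → proper rainbow i)

    compatible′ : ∀ {i j} → i ≢ j → Compatible (ρ′ i) (ρ′ j)
    compatible′ {i} {j} i≢j with i ≟ k | j ≟ k
    ... | yes refl | yes refl = contradiction refl i≢j
    ... | yes refl | no j≢k = subst₂ Compatible (sym at-k) (sym (elsewhere j≢k)) (x-compatible j j≢k)
    ... | no i≢k | yes refl = subst₂ Compatible (sym (elsewhere i≢k)) (sym at-k) (compatible-sym (x-compatible i i≢k))
    ... | no i≢k | no j≢k = subst₂ Compatible (sym (elsewhere i≢k)) (sym (elsewhere j≢k)) (compatible rainbow i≢j)

-- Short cycles

module _ {V : ℕ} {Adj : Fin V → Fin V → Set} where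

  cycle : {k : ℕ} (v : Fin (suc k) → Fin V) → v (fromℕ k) ≡ v zero →
    (∀ i → Adj (v (inject₁ i)) (v (suc i))) → Unique (tabulate (v ∘′ inject₁)) → HasCycle Adj k
  cycle v closed adjacent distinct = v , closed , adjacent , λ _ _ → unique-tabulate⇒injective distinct

  triangle : {a b c : Fin V} → Unique (a ∷ b ∷ c ∷ []) →
    Adj a b → Adj b c → Adj c a → HasCycle Adj 3
  triangle {a} {b} {c} distinct ab bc ca = cycle (Vec.lookup walk) refl adjacent distinct
    where
    walk : Vec (Fin V) 4
    walk = a ∷ b ∷ c ∷ a ∷ []
    adjacent : ∀ i → Adj (Vec.lookup walk (inject₁ i)) (Vec.lookup walk (suc i))
    adjacent 0F = ab
    adjacent 1F = bc
    adjacent 2F = ca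

  pentagon : {a b c d e : Fin V} → Unique (a ∷ b ∷ c ∷ d ∷ e ∷ []) →
    Adj a b → Adj b c → Adj c d → Adj d e → Adj e a → HasCycle Adj 5
  pentagon {a} {b} {c} {d} {e} distinct ab bc cd de ea = cycle (Vec.lookup walk) refl adjacent distinct
    where
    walk : Vec (Fin V) 6
    walk = a ∷ b ∷ c ∷ d ∷ e ∷ a ∷ []
    adjacent : ∀ i → Adj (Vec.lookup walk (inject₁ i)) (Vec.lookup walk (suc i))
    adjacent 0F = ab
    adjacent 1F = bc
    adjacent 2F = cd
    adjacent 3F = de
    adjacent 4F = ea

-- Counting

∑-mono-≤ : ∀ {m} {f g : Fin m → ℕ} → (∀ i → f i ≤ g i) → sum f ≤ sum g
∑-mono-≤ {zero} _ = z≤n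
∑-mono-≤ {suc m} f≤g = +-mono-≤ (f≤g zero) (∑-mono-≤ (f≤g ∘ suc))

∑-zero : ∀ {m} {f : Fin m → ℕ} → (∀ i → f i ≡ 0) → sum f ≡ 0
∑-zero {m} f≡0 = trans (sum-cong-≗ f≡0) (sum-replicate-zero m)

∑-const : ∀ m c → ∑[ i < m ] c ≡ m * c
∑-const zero c = refl
∑-const (suc m) c = cong (c +_) (∑-const m c)

∑-positive : ∀ {m} (f : Fin m → ℕ) → 0 < sum f → ∃ λ i → 0 < f i
∑-positive {suc m} f 0<∑ with f zero in f₀≡
... | suc _ = zero , subst (0 <_) (sym f₀≡) (s≤s z≤n)
... | zero with i , 0<fᵢ ← ∑-positive (f ∘ suc) 0<∑ = suc i , 0<fᵢ

sum-tabulate : ∀ {m} (f : Fin m → ℕ) → List.sum (tabulate f) ≡ sum f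
sum-tabulate {zero} f = refl
sum-tabulate {suc m} f = cong (f zero +_) (sum-tabulate (f ∘ suc))

sum-map-allFin : ∀ {m} (f : Fin m → ℕ) → List.sum (map f (allFin m)) ≡ sum f
sum-map-allFin f = trans (cong List.sum (map-tabulate id f)) (sum-tabulate f)

indicator : {A : Set} → Dec A → ℕ
indicator (yes _) = 1
indicator (no _) = 0

count : ∀ {m} {P : Pred (Fin m) 0ℓ} → Decidable P → ℕ
count {m} P? = ∑[ i < m ] indicator (P? i)

length-filter-tabulate : ∀ {A : Set} {m} {P : Pred A 0ℓ} (P? : Decidable P) (g : Fin m → A) →
  length (filter P? (tabulate g)) ≡ count (P? ∘ g)
length-filter-tabulate {m = zero} P? g = refl
length-filter-tabulate {m = suc m} P? g with P? (g zero)
... | yes _ = cong suc (length-filter-tabulate P? (g ∘ suc))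
... | no _ = length-filter-tabulate P? (g ∘ suc)

indicator-positive : {A : Set} (d : Dec A) → 0 < indicator d → A
indicator-positive (yes a) _ = a

indicator-cong : {A B : Set} (d : Dec A) (d′ : Dec B) → (A → B) → (B → A) → indicator d ≡ indicator d′
indicator-cong (yes _) (yes _) _ _ = refl
indicator-cong (yes a) (no ¬b) A→B _ = contradiction (A→B a) ¬b
indicator-cong (no ¬a) (yes b) _ B→A = contradiction (B→A b) ¬a
indicator-cong (no _) (no _) _ _ = refl

module _ {m : ℕ} {P : Pred (Fin m) 0ℓ} (P? : Decidable P) where

  count-positive : 0 < count P? → ∃ P
  count-positive 0<count with i , 0<indicator ← ∑-positive (indicator ∘ P?) 0<count =
    i , indicator-positive (P? i) 0<indicator

  count-empty : (∀ i → ¬ P i) → count P? ≡ 0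
  count-empty ¬P = ∑-zero λ i → indicator-cong (P? i) (no (λ ())) (¬P i) λ ()

  _∖?_ : (c : Fin m) → Decidable (λ i → P i × i ≢ c)
  _∖?_ c i = P? i ×-dec ¬? (i ≟ c)

count-cong : ∀ {m} {P Q : Pred (Fin m) 0ℓ} (P? : Decidable P) (Q? : Decidable Q) →
  (∀ {i} → P i → Q i) → (∀ {i} → Q i → P i) → count P? ≡ count Q?
count-cong P? Q? P⇒Q Q⇒P = sum-cong-≗ λ i → indicator-cong (P? i) (Q? i) P⇒Q Q⇒P

count-unique : ∀ {m} {P : Pred (Fin m) 0ℓ} (P? : Decidable P) {i : Fin m} →
  P i → (∀ {j} → P j → j ≡ i) → count P? ≡ 1
count-unique P? {zero} p unique with P? zero
... | yes _ = cong suc (count-empty (P? ∘ suc) λ j p′ → contradiction (unique p′) λ ())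
... | no ¬p = contradiction p ¬p
count-unique P? {suc i} p unique with P? zero
... | yes p₀ = contradiction (unique p₀) λ ()
... | no _ = count-unique (P? ∘ suc) p λ p′ → suc-injective (unique p′)

module _ {m : ℕ} {P : Pred (Fin m) 0ℓ} (P? : Decidable P) where

  count-∖ : ∀ c → count P? ≤ suc (count (P? ∖? c))
  count-∖ c = begin
    count P?
      ≤⟨ ∑-mono-≤ split ⟩
    ∑[ i < m ] (indicator ((P? ∖? c) i) + indicator (i ≟ c))
      ≡⟨ ∑-distrib-+ (indicator ∘ (P? ∖? c)) (indicator ∘ (_≟ c)) ⟩
    count (P? ∖? c) + count (_≟ c)
      ≡⟨ cong (count (P? ∖? c) +_) (count-unique (_≟ c) refl id) ⟩
    count (P? ∖? c) + 1
      ≡⟨ +-comm _ 1 ⟩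
    suc (count (P? ∖? c)) ∎
    where
    open ≤-Reasoning
    split : ∀ i → indicator (P? i) ≤ indicator ((P? ∖? c) i) + indicator (i ≟ c)
    split i with P? i | i ≟ c
    ... | yes _ | yes _ = s≤s z≤n
    ... | yes _ | no _ = s≤s z≤n
    ... | no _ | _ = z≤n

  two-avoid-one : 2 ≤ count P? → ∀ c → ∃ λ i → P i × i ≢ c
  two-avoid-one 2≤count c = count-positive (P? ∖? c) (≤-pred (≤-trans 2≤count (count-∖ c)))

three-avoid-two : ∀ {m} {P : Pred (Fin m) 0ℓ} (P? : Decidable P) → 3 ≤ count P? →
  ∀ c d → ∃ λ i → P i × i ≢ c × i ≢ d
three-avoid-two P? 3≤count c d
  with i , (p , i≢c) , i≢d ← two-avoid-one (P? ∖? c) (≤-pred (≤-trans 3≤count (count-∖ P? c))) d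
  = i , p , i≢c , i≢d

-- In the application W j k l says that j ∈ J and {e k, e l} is half-j-wasteful, and D k j that
-- j ∈ HW(e k).
module Discharging {n q : ℕ}
  (W : Fin n → Fin q → Fin q → Set) (D : Fin q → Fin n → Set) (D? : ∀ k → Decidable (D k))
  (D⇒W : ∀ {k j} → D k j → ∃ (W j k)) (W⇒D : ∀ {j k l} → W j k l → D k j)
  (W-sym : ∀ {j k l} → W j k l → W j l k) (W-unique : ∀ {j k l l′} → W j k l → W j k l′ → l ≡ l′)
  (no-three-colours : ∀ {j k l α β} → W j k l → D k α → D l β → j ≢ α → j ≢ β → α ≢ β → ⊥)
  where

  -- Decided by comparing l with the unique partner of k.
  W? : ∀ j k → Decidable (W j k)
  W? j k l with D? k j
  ... | no ¬d = no (¬d ∘ W⇒D)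
  ... | yes d with D⇒W d
  ...   | l′ , w′ with l ≟ l′
  ...     | yes refl = yes w′
  ...     | no l≢l′ = no λ w → l≢l′ (W-unique w w′)

  deg : Fin q → ℕ
  deg k = count (D? k)

  w : Fin q → Fin q → ℕ
  w k l = count (λ j → W? j k l)

  deg≡∑w : ∀ k → deg k ≡ ∑[ l < q ] w k l
  deg≡∑w k = trans (sum-cong-≗ one-partner) (∑-comm (λ j l → indicator (W? j k l)))
    where
    one-partner : ∀ j → indicator (D? k j) ≡ count (W? j k)
    one-partner j = by-cases (D? k j)
      where
      by-cases : (d : Dec (D k j)) → indicator d ≡ count (W? j k)
      by-cases (yes d) = let _ , w = D⇒W d in sym (count-unique (W? j k) w (λ w′ → W-unique w′ w))
      by-cases (no ¬d) = sym (count-empty (W? j k) (λ _ w → ¬d (W⇒D w)))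

  w-sym : ∀ k l → w k l ≡ w l k
  w-sym k l = count-cong (λ j → W? j k l) (λ j → W? j l k) W-sym W-sym

  no-rich-partner : ∀ {j k l} → 3 ≤ deg l → 2 ≤ deg k → ¬ W j l k
  no-rich-partner {j} {k} {l} 3≤deg-l 2≤deg-k w
    with β , β∈k , β≢j ← two-avoid-one (D? k) 2≤deg-k j
    with α , α∈l , α≢j , α≢β ← three-avoid-two (D? l) 3≤deg-l j β
    = no-three-colours w α∈l β∈k (≢-sym α≢j) (≢-sym β≢j) α≢β

  charge : Fin q → Fin q → ℕ
  charge k l = indicator (3 ≤? deg k) * w k l

  charge-of-rich : ∀ {k l} → 3 ≤ deg k → charge k l ≡ w k l
  charge-of-rich {k} {l} rich with 3 ≤? deg k
  ... | yes _ = +-identityʳ (w k l)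
  ... | no poor = contradiction rich poor

  charge-of-poor : ∀ {k l} → ¬ 3 ≤ deg k → charge k l ≡ 0
  charge-of-poor {k} poor with 3 ≤? deg k
  ... | yes rich = contradiction rich poor
  ... | no _ = refl

  charge-≤ : ∀ k l → charge k l ≤ w k l
  charge-≤ k l with 3 ≤? deg k
  ... | yes _ = ≤-reflexive (+-identityʳ (w k l))
  ... | no _ = z≤n

  charge-positive : ∀ {k l} → 0 < charge k l → 3 ≤ deg k
  charge-positive {k} 0<charge with 3 ≤? deg k
  ... | yes rich = rich
  ... | no _ = contradiction 0<charge λ ()

  rich-uncharged : ∀ {k} → 2 ≤ deg k → ∑[ l < q ] charge l k ≡ 0
  rich-uncharged {k} 2≤deg-k = ∑-zero λ l → n≤0⇒n≡0 (≮⇒≥ (uncharged l))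
    where
    uncharged : ∀ l → ¬ 0 < charge l k
    uncharged l 0<charge with _ , w ← count-positive (λ j → W? j l k) (≤-trans 0<charge (charge-≤ l k))
      = no-rich-partner (charge-positive 0<charge) 2≤deg-k w

  received-≤-deg : ∀ k → ∑[ l < q ] charge l k ≤ deg k
  received-≤-deg k = begin
    ∑[ l < q ] charge l k ≤⟨ ∑-mono-≤ (λ l → charge-≤ l k) ⟩
    ∑[ l < q ] w l k      ≡⟨ sum-cong-≗ (λ l → w-sym l k) ⟩
    ∑[ l < q ] w k l      ≡⟨ deg≡∑w k ⟨
    deg k                 ∎
    where open ≤-Reasoning

  balance : ∀ k → deg k + ∑[ l < q ] charge l k ≤ 2 + ∑[ l < q ] charge k l
  balance k = by-cases (3 ≤? deg k) (2 ≤? deg k)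
    where
    open ≤-Reasoning
    by-cases : Dec (3 ≤ deg k) → Dec (2 ≤ deg k) → deg k + ∑[ l < q ] charge l k ≤ 2 + ∑[ l < q ] charge k l
    by-cases (yes rich) _ = begin
      deg k + ∑[ l < q ] charge l k ≡⟨ cong (deg k +_) (rich-uncharged (≤-trans (s≤s (s≤s z≤n)) rich)) ⟩
      deg k + 0                     ≡⟨ +-identityʳ (deg k) ⟩
      deg k                         ≤⟨ m≤n+m (deg k) 2 ⟩
      2 + deg k                     ≡⟨ cong (2 +_) (deg≡∑w k) ⟩
      2 + ∑[ l < q ] w k l          ≡⟨ cong (2 +_) (sum-cong-≗ λ l → charge-of-rich {k} {l} rich) ⟨
      2 + ∑[ l < q ] charge k l     ∎
    by-cases (no poor) (yes 2≤deg-k) = begin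
      deg k + ∑[ l < q ] charge l k ≡⟨ cong (deg k +_) (rich-uncharged 2≤deg-k) ⟩
      deg k + 0                     ≤⟨ +-mono-≤ (≤-pred (≰⇒> poor)) z≤n ⟩
      2 + 0                         ≡⟨ cong (2 +_) (∑-zero λ l → charge-of-poor {k} {l} poor) ⟨
      2 + ∑[ l < q ] charge k l     ∎
    by-cases (no poor) (no deg-k≱2) = begin
      deg k + ∑[ l < q ] charge l k ≤⟨ +-mono-≤ deg-k≤1 (≤-trans (received-≤-deg k) deg-k≤1) ⟩
      1 + 1                         ≡⟨ cong (2 +_) (∑-zero λ l → charge-of-poor {k} {l} poor) ⟨
      2 + ∑[ l < q ] charge k l     ∎
      where
      deg-k≤1 : deg k ≤ 1
      deg-k≤1 = ≤-pred (≰⇒> deg-k≱2)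

  degree-sum-≤ : ∑[ k < q ] deg k ≤ 2 * q
  degree-sum-≤ = +-cancelʳ-≤ (∑[ k < q ] ∑[ l < q ] charge k l) _ _ (begin
    ∑[ k < q ] deg k + ∑[ k < q ] ∑[ l < q ] charge k l
      ≡⟨ cong (∑[ k < q ] deg k +_) (∑-comm (λ k l → charge l k)) ⟨
    ∑[ k < q ] deg k + ∑[ k < q ] ∑[ l < q ] charge l k
      ≡⟨ ∑-distrib-+ deg (λ k → ∑[ l < q ] charge l k) ⟨
    ∑[ k < q ] (deg k + ∑[ l < q ] charge l k)
      ≤⟨ ∑-mono-≤ balance ⟩
    ∑[ k < q ] (2 + ∑[ l < q ] charge k l)
      ≡⟨ ∑-distrib-+ (λ _ → 2) (λ k → ∑[ l < q ] charge k l) ⟩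
    ∑[ k < q ] 2 + ∑[ k < q ] ∑[ l < q ] charge k l
      ≡⟨ cong (_+ ∑[ k < q ] ∑[ l < q ] charge k l) (trans (∑-const q 2) (*-comm q 2)) ⟩
    2 * q + ∑[ k < q ] ∑[ l < q ] charge k l ∎)
    where open ≤-Reasoning

  card-sum-≤ : List.sum (map (λ k → length (filter (D? k) (allFin n))) (allFin q)) ≤ 2 * q
  card-sum-≤ = subst (_≤ 2 * q) (sym card-sum≡degree-sum) degree-sum-≤
    where
    card-sum≡degree-sum : List.sum (map (λ k → length (filter (D? k) (allFin n))) (allFin q)) ≡ ∑[ k < q ] deg k
    card-sum≡degree-sum = trans (sum-map-allFin (λ k → length (filter (D? k) (allFin n))))
      (sum-cong-≗ λ k → length-filter-tabulate (D? k) id)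

module MaximumRainbow {V n : ℕ} (Adj : Fin V → Fin V → Set) (Adj-sym : ∀ {u v} → Adj u v → Adj v u)
  (no-triangle : ¬ HasCycle Adj 3) (no-pentagon : ¬ HasCycle Adj 5)
  (F : Fin n → List (Edge V)) (F-matching : ∀ i → IsMatching (F i))
  (F-adjacent : ∀ i → All (λ { (u , v) → Adj u v }) (F i))
  (R : List (Edge V × Fin n)) (R-maximum : IsMaxRainbow F R) where

  open Rainbow

  q : ℕ
  q = length R

  e : Fin q → Edge V
  e = edgeOf F R

  R-rainbow : Rainbow F (lookup R)
  R-rainbow = lookup-rainbow F (proj₁ R-maximum)

  no-larger-rainbow : {ρ : Fin (suc q) → Item F} → Rainbow F ρ → ⊥
  no-larger-rainbow {ρ} rainbow =
    1+n≰n (subst (_≤ q) (length-tabulate ρ) (proj₂ R-maximum _ (tabulate-rainbow F rainbow)))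

  R-shared-vertex : ∀ {k l v} → v ∈ᵥ e k → v ∈ᵥ e l → k ≡ l
  R-shared-vertex = matching-shared-vertex⇒≡ proj₁ R (proj₁ (proj₁ R-maximum))

  R-vertices-distinct : ∀ {k l u v} → k ≢ l → u ∈ᵥ e k → v ∈ᵥ e l → u ≢ v
  R-vertices-distinct k≢l u∈k v∈l refl = k≢l (R-shared-vertex u∈k v∈l)

  Uncovered : Fin V → Set
  Uncovered x = ∀ k → ¬ x ∈ᵥ e k

  uncovered-≢ : ∀ {x v k} → Uncovered x → v ∈ᵥ e k → v ≢ x
  uncovered-≢ x-uncovered v∈k refl = x-uncovered _ v∈k

  adjacent : ∀ {i u v} → (u , v) ∈ₑ F i → Adj u v
  adjacent {i} (inj₁ uv∈F) = All.lookup (F-adjacent i) uv∈F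
  adjacent {i} (inj₂ vu∈F) = Adj-sym (All.lookup (F-adjacent i) vu∈F)

  R-adjacent : ∀ {k u v} → u ∈ᵥ e k → v ∈ᵥ e k → u ≢ v → Adj u v
  R-adjacent {k} u∈k v∈k u≢v = adjacent (∈ₑ-from-vertices (proj₁ (proper R-rainbow k)) u∈k v∈k u≢v)

  -- Items that may take the place of e k and e l in R.
  Fresh : Fin q → Fin q → Item F → Set
  Fresh k l (g , c) = InJ F R c × (∀ i → i ≢ k → i ≢ l → ¬ Meets g (e i))

  fresh-compatible : ∀ {k l i x} → Fresh k l x → i ≢ k → i ≢ l → Compatible F x (lookup R i)
  fresh-compatible {i = i} (c∈J , avoids) i≢k i≢l =
    (λ { refl → c∈J (∈-map⁺ proj₂ (∈-lookup {xs = R} i)) }) , avoids i i≢k i≢l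

  pendant-proper : ∀ {k c a x} → (a , x) ∈ₑ F c → a ∈ᵥ e k → Uncovered x → Proper F ((a , x) , c)
  pendant-proper ax∈F a∈k x-uncovered = ax∈F , uncovered-≢ x-uncovered a∈k

  pendant-fresh : ∀ {k l c a x} → InJ F R c → a ∈ᵥ e k → Uncovered x → Fresh k l ((a , x) , c)
  pendant-fresh {k} {l} {a = a} {x} c∈J a∈k x-uncovered = c∈J , avoids
    where
    avoids : ∀ i → i ≢ k → i ≢ l → ¬ Meets (a , x) (e i)
    avoids i i≢k _ m with shared-vertex m
    ... | _ , inj₁ refl , a∈i = i≢k (R-shared-vertex a∈i a∈k)
    ... | _ , inj₂ refl , x∈i = x-uncovered i x∈i

  chord-fresh : ∀ {k l c a b} → InJ F R c → a ∈ᵥ e k → b ∈ᵥ e l → Fresh k l ((a , b) , c)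
  chord-fresh {k} {l} {a = a} {b} c∈J a∈k b∈l = c∈J , avoids
    where
    avoids : ∀ i → i ≢ k → i ≢ l → ¬ Meets (a , b) (e i)
    avoids i i≢k i≢l m with shared-vertex m
    ... | _ , inj₁ refl , a∈i = i≢k (R-shared-vertex a∈i a∈k)
    ... | _ , inj₂ refl , b∈i = i≢l (R-shared-vertex b∈i b∈l)

  exchange₁ : ∀ {k x y} → Proper F x → Proper F y → Fresh k k x → Fresh k k y → Compatible F x y → ⊥
  exchange₁ {k} {x} {y} x-proper y-proper x-fresh y-fresh x~y =
    no-larger-rainbow (cons-rainbow F ρ-rainbow x-proper x~ρ)
    where
    ρ : Fin q → Item F
    ρ = updateAt (lookup R) k (const y)

    ρ-rainbow : Rainbow F ρ
    ρ-rainbow = update-rainbow F R-rainbow y-proper (λ i i≢k → fresh-compatible y-fresh i≢k i≢k)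

    x~ρ : ∀ i → Compatible F x (ρ i)
    x~ρ = updateAt-elim (λ _ → Compatible F x) x~y (λ i i≢k → fresh-compatible x-fresh i≢k i≢k)

  exchange₂ : ∀ {k l x y z} → Proper F x → Proper F y → Proper F z →
    Fresh k l x → Fresh k k y → Fresh l l z → Compatible F x y → Compatible F x z → Compatible F y z → ⊥
  exchange₂ {k} {l} {x} {y} {z} x-proper y-proper z-proper x-fresh y-fresh z-fresh x~y x~z y~z =
    no-larger-rainbow (cons-rainbow F ρ₂-rainbow x-proper x~ρ₂)
    where
    ρ₁ ρ₂ : Fin q → Item F
    ρ₁ = updateAt (lookup R) k (const y)
    ρ₂ = updateAt ρ₁ l (const z)

    ρ₂-rainbow : Rainbow F ρ₂
    ρ₂-rainbow = update-rainbow F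
      (update-rainbow F R-rainbow y-proper (λ i i≢k → fresh-compatible y-fresh i≢k i≢k))
      z-proper
      (updateAt-elim (λ i w → i ≢ l → Compatible F z w) (λ _ → compatible-sym F y~z)
        (λ i _ i≢l → fresh-compatible z-fresh i≢l i≢l))

    x~ρ₂ : ∀ i → Compatible F x (ρ₂ i)
    x~ρ₂ = updateAt-elim (λ _ → Compatible F x) x~z
      (updateAt-elim (λ i w → i ≢ l → Compatible F x w) (λ _ → x~y)
        (λ i i≢k i≢l → fresh-compatible x-fresh i≢k i≢l))

  meets-only-apart : ∀ {i k l g h u v} → g ∈ F i → MeetsOnly F R k g → h ∈ F i → Meets h (e l) → l ≢ k →
    u ∈ᵥ g → v ∈ᵥ h → u ≢ v
  meets-only-apart {i} {l = l} g∈F (_ , g-only) h∈F h∩l l≢k u∈g v∈h refl =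
    g-only l l≢k (subst (λ g′ → Meets g′ (e l))
      (sym (matching-shared-vertex⇒same-edge (F-matching i) g∈F h∈F u∈g v∈h)) h∩l)

  pendant : ∀ {i k l g h b} → g ∈ F i → MeetsOnly F R k g → h ∈ F i → Meets h (e l) → l ≢ k →
    b ∈ᵥ h → b ∈ᵥ e k → ∃₂ λ a x → a ∈ᵥ e k × a ≢ b × (a , x) ∈ₑ F i × Uncovered x
  pendant {i} {k} {l} {g} {h} {b} g∈F g-meets-only h∈F h∩l l≢k b∈h b∈k
    with a , a∈g , a∈k ← shared-vertex (proj₁ g-meets-only)
    with x , x∈g , a≢x ← other-vertex (matching-ends-distinct (F-matching i) g∈F) a∈g
    = a , x , a∈k , a≢b , ∈ₑ-from-vertices (inj₁ g∈F) a∈g x∈g a≢x , x-uncovered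
    where
    apart : ∀ {u v} → u ∈ᵥ g → v ∈ᵥ h → u ≢ v
    apart = meets-only-apart g∈F g-meets-only h∈F h∩l l≢k

    a≢b : a ≢ b
    a≢b = apart a∈g b∈h

    x-uncovered : Uncovered x
    x-uncovered k′ x∈k′ with k′ ≟ k
    ... | yes refl = apart x∈g b∈h (sym (other-vertex-unique a∈k b∈k x∈k′ a≢b a≢x))
    ... | no k′≢k = proj₂ g-meets-only k′ k′≢k (meets x∈g x∈k′)

  hw-pendant : ∀ {k α} → HW F R k α → ∃₂ λ a x → a ∈ᵥ e k × (a , x) ∈ₑ F α × Uncovered x
  hw-pendant (_ , _ , k≢l , gA , _ , hA)
    with _ , g∈F , g-meets-only ← find gA
    with _ , h∈F , h∩k , h∩l ← find hA
    with _ , b∈h , b∈k ← shared-vertex h∩k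
    with a , x , a∈k , _ , ax∈F , x-uncovered ← pendant g∈F g-meets-only h∈F h∩l (≢-sym k≢l) b∈h b∈k
    = a , x , a∈k , ax∈F , x-uncovered

  no-short-augmenting-path : ∀ {j α k a a′ x x′} → j ≢ α → InJ F R j → InJ F R α →
    a ∈ᵥ e k → a′ ∈ᵥ e k → a ≢ a′ → (a , x) ∈ₑ F j → (a′ , x′) ∈ₑ F α → Uncovered x → Uncovered x′ → ⊥
  no-short-augmenting-path {x = x} {x′} j≢α j∈J α∈J a∈k a′∈k a≢a′ ax∈F a′x′∈F x-unc x′-unc with x ≟ x′
  ... | yes refl = no-triangle (triangle
          ((a≢a′ ∷ uncovered-≢ x-unc a∈k ∷ []) ∷ (uncovered-≢ x-unc a′∈k ∷ []) ∷ [] ∷ [])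
          (R-adjacent a∈k a′∈k a≢a′) (adjacent a′x′∈F) (adjacent (∈ₑ-swap ax∈F)))
  ... | no x≢x′ = exchange₁
          (pendant-proper ax∈F a∈k x-unc) (pendant-proper a′x′∈F a′∈k x′-unc)
          (pendant-fresh j∈J a∈k x-unc) (pendant-fresh α∈J a′∈k x′-unc)
          (j≢α , ¬meets a≢a′ (uncovered-≢ x′-unc a∈k) (≢-sym (uncovered-≢ x-unc a′∈k)) x≢x′)

  pendants-agree : ∀ {j α k a x a′ x′} → j ≢ α → InJ F R j → InJ F R α →
    a ∈ᵥ e k → (a , x) ∈ₑ F j → Uncovered x → a′ ∈ᵥ e k → (a′ , x′) ∈ₑ F α → Uncovered x′ → a′ ≡ a
  pendants-agree {a = a} {a′ = a′} j≢α j∈J α∈J a∈k ax∈F x-unc a′∈k a′x′∈F x′-unc with a′ ≟ a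
  ... | yes a′≡a = a′≡a
  ... | no a′≢a = ⊥-elim
          (no-short-augmenting-path j≢α j∈J α∈J a∈k a′∈k (≢-sym a′≢a) ax∈F a′x′∈F x-unc x′-unc)

  no-augmenting-path : ∀ {j α β k l a b c d x y} → k ≢ l → InJ F R j → InJ F R α → InJ F R β →
    j ≢ α → j ≢ β → α ≢ β → a ∈ᵥ e k → b ∈ᵥ e k → c ∈ᵥ e l → d ∈ᵥ e l → a ≢ b → c ≢ d →
    (b , c) ∈ₑ F j → (a , x) ∈ₑ F α → (d , y) ∈ₑ F β → Uncovered x → Uncovered y → ⊥
  no-augmenting-path {a = a} {b} {c} {d} {x} {y}
    k≢l j∈J α∈J β∈J j≢α j≢β α≢β a∈k b∈k c∈l d∈l a≢b c≢d bc∈F ax∈F dy∈F x-unc y-unc = by-cases (x ≟ y)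
    where
    a≢c : a ≢ c
    a≢c = R-vertices-distinct k≢l a∈k c∈l
    a≢d : a ≢ d
    a≢d = R-vertices-distinct k≢l a∈k d∈l
    b≢c : b ≢ c
    b≢c = R-vertices-distinct k≢l b∈k c∈l
    b≢d : b ≢ d
    b≢d = R-vertices-distinct k≢l b∈k d∈l

    by-cases : Dec (x ≡ y) → ⊥
    by-cases (yes x≡y) = no-pentagon (pentagon
      ((a≢b ∷ a≢c ∷ a≢d ∷ uncovered-≢ x-unc a∈k ∷ []) ∷ (b≢c ∷ b≢d ∷ uncovered-≢ x-unc b∈k ∷ []) ∷
       (c≢d ∷ uncovered-≢ x-unc c∈l ∷ []) ∷ (uncovered-≢ x-unc d∈l ∷ []) ∷ [] ∷ [])
      (R-adjacent a∈k b∈k a≢b) (adjacent bc∈F) (R-adjacent c∈l d∈l c≢d)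
      (subst (Adj _) (sym x≡y) (adjacent dy∈F)) (adjacent (∈ₑ-swap ax∈F)))
    by-cases (no x≢y) = exchange₂
      (bc∈F , b≢c) (pendant-proper ax∈F a∈k x-unc) (pendant-proper dy∈F d∈l y-unc)
      (chord-fresh j∈J b∈k c∈l) (pendant-fresh α∈J a∈k x-unc) (pendant-fresh β∈J d∈l y-unc)
      (j≢α , ¬meets (≢-sym a≢b) (uncovered-≢ x-unc b∈k) (≢-sym a≢c) (uncovered-≢ x-unc c∈l))
      (j≢β , ¬meets b≢d (uncovered-≢ y-unc b∈k) c≢d (uncovered-≢ y-unc c∈l))
      (α≢β , ¬meets a≢d (uncovered-≢ y-unc a∈k) (≢-sym (uncovered-≢ x-unc d∈l)) x≢y)

  no-three-colours : ∀ {j k l α β} → InJ F R j → HalfWasteful F R j k l → HW F R k α → HW F R l β →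
    j ≢ α → j ≢ β → α ≢ β → ⊥
  no-three-colours j∈J (k≢l , gₖA , gₗA , hA) α∈HW@(α∈J , _) β∈HW@(β∈J , _) j≢α j≢β α≢β
    with _ , gₖ∈F , gₖ-meets-only ← find gₖA
    with _ , gₗ∈F , gₗ-meets-only ← find gₗA
    with _ , h∈F , h∩k , h∩l ← find hA
    with b , b∈h , b∈k ← shared-vertex h∩k
    with c , c∈h , c∈l ← shared-vertex h∩l
    with a , x , a∈k , a≢b , ax∈F , x-unc ← pendant gₖ∈F gₖ-meets-only h∈F h∩l (≢-sym k≢l) b∈h b∈k
    with d , y , d∈l , d≢c , dy∈F , y-unc ← pendant gₗ∈F gₗ-meets-only h∈F h∩k k≢l c∈h c∈l
    with a′ , x′ , a′∈k , a′x′∈F , x′-unc ← hw-pendant α∈HW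
    with d′ , y′ , d′∈l , d′y′∈F , y′-unc ← hw-pendant β∈HW
    with refl ← pendants-agree j≢α j∈J α∈J a∈k ax∈F x-unc a′∈k a′x′∈F x′-unc
    with refl ← pendants-agree j≢β j∈J β∈J d∈l dy∈F y-unc d′∈l d′y′∈F y′-unc
    = no-augmenting-path k≢l j∈J α∈J β∈J j≢α j≢β α≢β a∈k b∈k c∈l d∈l a≢b (≢-sym d≢c)
        (∈ₑ-from-vertices (inj₁ h∈F) b∈h c∈h (R-vertices-distinct k≢l b∈k c∈l)) a′x′∈F d′y′∈F x′-unc y′-unc

  partner-unique : ∀ {j k l l′} → HalfWasteful F R j k l → HalfWasteful F R j k l′ → l ≡ l′
  partner-unique {j} (k≢l , gA , _ , h₁A) (k≢l′ , _ , _ , h₂A)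
    with _ , g∈F , g-meets-only ← find gA
    with _ , h₁∈F , h₁∩k , h₁∩l ← find h₁A
    with _ , h₂∈F , h₂∩k , h₂∩l′ ← find h₂A
    with u , u∈g , u∈k ← shared-vertex (proj₁ g-meets-only)
    with v , v∈h₁ , v∈k ← shared-vertex h₁∩k
    with w , w∈h₂ , w∈k ← shared-vertex h₂∩k
    with refl ← other-vertex-unique u∈k v∈k w∈k
                  (meets-only-apart g∈F g-meets-only h₁∈F h₁∩l (≢-sym k≢l) u∈g v∈h₁)
                  (meets-only-apart g∈F g-meets-only h₂∈F h₂∩l′ (≢-sym k≢l′) u∈g w∈h₂)
    with refl ← matching-shared-vertex⇒same-edge (F-matching j) h₁∈F h₂∈F v∈h₁ w∈h₂
    with c , c∈h₁ , c∈l ← shared-vertex h₁∩l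
    with c′ , c′∈h₁ , c′∈l′ ← shared-vertex h₂∩l′
    with refl ← other-vertex-unique v∈h₁ c∈h₁ c′∈h₁
                  (R-vertices-distinct k≢l v∈k c∈l) (R-vertices-distinct k≢l′ v∈k c′∈l′)
    = R-shared-vertex c∈l c′∈l′

  half-wasteful-sym : ∀ {j k l} → HalfWasteful F R j k l → HalfWasteful F R j l k
  half-wasteful-sym (k≢l , gₖA , gₗA , hA) = ≢-sym k≢l , gₗA , gₖA , Any.map swap hA

lemma2p6 : (V n : ℕ) (Adj : Fin V → Fin V → Set)
    → (∀ {u v} → Adj u v → Adj v u)
    → (∀ {u} → ¬ Adj u u)
    → ¬ HasCycle Adj 3
    → ¬ HasCycle Adj 5
    → (F : Fin n → List (Edge V))
    → (∀ i → IsMatching (F i))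
    → (∀ i → length (F i) ≡ n)
    → (∀ i → All (λ { (u , v) → Adj u v }) (F i))
    → (R : List (Edge V × Fin n))
    → IsMaxRainbow F R
    → sumHW F R ≤ 2 * length R
lemma2p6 V n Adj Adj-sym _ no-triangle no-pentagon F F-matching _ F-adjacent R R-maximum =
  Discharging.card-sum-≤ (λ j k l → InJ F R j × HalfWasteful F R j k l) (HW F R) (HW? F R)
    (λ (j∈J , l , w) → l , j∈J , w) (λ (j∈J , w) → j∈J , _ , w)
    (λ (j∈J , w) → j∈J , half-wasteful-sym w) (λ (_ , w) (_ , w′) → partner-unique w w′)
    (λ (j∈J , w) → no-three-colours j∈J w)
  where open MaximumRainbow Adj Adj-sym no-triangle no-pentagon F F-matching F-adjacent R R-maximum
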